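{- Let $G=(V,E)$ be a graph and let $u,v\in V$ be distinct. Then there exists a co-lex relation on $G$ containing $(u,v)$ if and only if for all pairs $(u',v')$ preceding $(u,v)$ it holds $\lambda(u')\,\angle\,\lambda(v')$. In this case there exists a minimum co-lex relation containing $(u,v)$, i.e. a co-lex relation containing $(u,v)$ that is contained in every co-lex relation containing $(u,v)$.
   Context: $\Sigma$ is a finite alphabet with a fixed total order $\preceq$. A graph is $G=(V,E)$ with $V$ finite and $E\subseteq V\times V\times\Sigma$. Let $\#\notin\Sigma$ with $\#\prec a$ for all $a\in\Sigma$. For $v\in V$, $\lambda(v)$ is the set of labels of edges entering $v$ if $v$ has incoming edges, and $\{\#\}$ otherwise. Write $\lambda(u)\,\angle\,\lambda(v)$ iff $a\preceq b$ for all $a\in\lambda(u)$, $b\in\lambda(v)$. A co-lex relation on $G$ is a reflexive $R\subseteq V\times V$ such that (Axiom 1) $u\neq v$, $(u,v)\in R$ implies $\lambda(u)\,\angle\,\lambda(v)$; (Axiom 2) for $(u',u,a),(v',v,a)\in E$ with $u\neq v$ and $(u,v)\in R$, $(u',v')\in R$. For pairs of distinct nodes $(u',v'),(u,v)$, $(u',v')$ precedes $(u,v)$ if there exist $r\ge1$, nodes $u_1,\dots,u_r,v_1,\dots,v_r$ and letters $a_1,\dots,a_{r-1}$ with $u_1=u'$, $v_1=v'$, $u_r=u$, $v_r=v$, $u_i\neq v_i$ for all $i$, and $(u_i,u_{i+1},a_i),(v_i,v_{i+1},a_i)\in E$ for $i=1,\dots,r-1$. -}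

module Defs where

open import Data.Nat using (ℕ)
open import Data.Fin using (Fin)
import Data.Fin as Fin
open import Data.Bool using (Bool; true)
open import Data.Maybe using (Maybe; just; nothing)
open import Data.Product using (_×_; ∃; Σ; _,_)
open import Data.Empty using (⊥)
open import Relation.Nullary using (¬_)
open import Relation.Binary.PropositionalEquality using (_≡_; _≢_)
open import Level using (Level; 0ℓ)

-- A graph with node set V = Fin n over the alphabet Σ = Fin k, whose total
-- order ⪯ is the usual order on Fin k.
record Graph (n k : ℕ) : Set where
  field
    edge : Fin n → Fin n → Fin k → Bool

open Graph public

Edge : ∀ {n k} → Graph n k → Fin n → Fin n → Fin k → Set
Edge G u v a = edge G u v a ≡ true

-- Extended alphabet Σ ∪ {#}: nothing = #, just a = a.
-- Order: # ≺ a for all a ∈ Σ, and on Σ the order of Fin k.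
data _⪯#_ {k : ℕ} : Maybe (Fin k) → Maybe (Fin k) → Set where
  #⪯ : ∀ {x} → nothing ⪯# x
  a⪯b : ∀ {a b} → a Fin.≤ b → just a ⪯# just b

data InLambda {n k} (G : Graph n k) (v : Fin n) : Maybe (Fin k) → Set where
  label : ∀ {u a} → Edge G u v a → InLambda G v (just a)
  hash  : (¬ ∃ λ u → ∃ λ a → Edge G u v a) → InLambda G v nothing

_∠_within_ : ∀ {n k} → Fin n → Fin n → Graph n k → Set
u ∠ v within G = ∀ x y → InLambda G u x → InLambda G v y → x ⪯# y

Rel : ℕ → Set₁
Rel n = Fin n → Fin n → Set

record IsCoLex {n k} (G : Graph n k) (R : Rel n) : Set where
  field
    reflexive : ∀ u → R u u
    axiom1    : ∀ u v → u ≢ v → R u v → u ∠ v within G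
    axiom2    : ∀ u' u v' v a → Edge G u' u a → Edge G v' v a →
                u ≢ v → R u v → R u' v'

data Precedes {n k} (G : Graph n k) : Fin n → Fin n → Fin n → Fin n → Set where
  here  : ∀ {u v} → u ≢ v → Precedes G u v u v
  there : ∀ {u' v' u₂ v₂ u v a} → u' ≢ v' →
          Edge G u' u₂ a → Edge G v' v₂ a →
          Precedes G u₂ v₂ u v → Precedes G u' v' u v

-- Axiom 2, applied along a chain, forces every pair preceding (u,v) into any
-- co-lex relation containing (u,v); there Axiom 1 gives the ∠-condition.
-- Conversely, the reflexive closure of the pairs preceding (u,v) is closed
-- under Axiom 2 by construction, so under the ∠-condition it is co-lex, and
-- by the first observation it is the minimum one.
module Submission where

open import Defs
open import Data.Nat using (ℕ)
open import Data.Fin using (Fin; _≟_)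
open import Data.Product using (Σ; _×_; _,_)
open import Data.Sum using (_⊎_; inj₁; inj₂)
open import Data.Empty using (⊥-elim)
open import Relation.Nullary using (yes; no)
open import Function.Bundles using (_⇔_; mk⇔)
open import Relation.Binary.PropositionalEquality using (_≢_; _≡_; refl)

PrecedingOrdered : ∀ {n k} → Graph n k → Fin n → Fin n → Set
PrecedingOrdered G u v = ∀ u' v' → Precedes G u' v' u v → u' ∠ v' within G

PrecedingClosure : ∀ {n k} → Graph n k → Fin n → Fin n → Rel n
PrecedingClosure G u v x y = x ≡ y ⊎ Precedes G x y u v

module _ {n k} {G : Graph n k} where

  Precedes-distinct : ∀ {x y u v} → Precedes G x y u v → x ≢ y
  Precedes-distinct (here x≢y)        = x≢y
  Precedes-distinct (there x≢y _ _ _) = x≢y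

  IsCoLex-preceding : ∀ {R} → IsCoLex G R →
    ∀ {x y u v} → Precedes G x y u v → R u v → R x y
  IsCoLex-preceding c (here _) Ruv = Ruv
  IsCoLex-preceding c (there {u'} {v'} {u₂} {v₂} {a = a} _ e e′ p) Ruv =
    IsCoLex.axiom2 c u' u₂ v' v₂ a e e′ (Precedes-distinct p)
      (IsCoLex-preceding c p Ruv)

  IsCoLex⇒PrecedingOrdered : ∀ {R u v} → IsCoLex G R → R u v →
    PrecedingOrdered G u v
  IsCoLex⇒PrecedingOrdered c Ruv x y p =
    IsCoLex.axiom1 c x y (Precedes-distinct p) (IsCoLex-preceding c p Ruv)

  PrecedingClosure-isCoLex : ∀ {u v} → PrecedingOrdered G u v →
    IsCoLex G (PrecedingClosure G u v)
  PrecedingClosure-isCoLex {u} {v} ordered = record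
    { reflexive = λ _ → inj₁ refl
    ; axiom1    = axiom1
    ; axiom2    = axiom2
    }
    where
    axiom1 : ∀ x y → x ≢ y → PrecedingClosure G u v x y → x ∠ y within G
    axiom1 x y x≢y (inj₁ x≡y) = ⊥-elim (x≢y x≡y)
    axiom1 x y _   (inj₂ p)   = ordered x y p

    axiom2 : ∀ x' x y' y a → Edge G x' x a → Edge G y' y a → x ≢ y →
      PrecedingClosure G u v x y → PrecedingClosure G u v x' y'
    axiom2 x' x y' y a e e′ x≢y (inj₁ x≡y) = ⊥-elim (x≢y x≡y)
    axiom2 x' x y' y a e e′ _   (inj₂ p) with x' ≟ y'
    ... | yes x'≡y' = inj₁ x'≡y'
    ... | no  x'≢y' = inj₂ (there x'≢y' e e′ p)

  PrecedingClosure-minimal : ∀ {R u v} → IsCoLex G R → R u v →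
    ∀ x y → PrecedingClosure G u v x y → R x y
  PrecedingClosure-minimal c Ruv x .x (inj₁ refl) = IsCoLex.reflexive c x
  PrecedingClosure-minimal c Ruv x y  (inj₂ p)    = IsCoLex-preceding c p Ruv

lemma5 : ∀ {n k} (G : Graph n k) (u v : Fin n) → u ≢ v →
    ((Σ (Rel n) λ R → IsCoLex G R × R u v)
      ⇔ (∀ u' v' → Precedes G u' v' u v → u' ∠ v' within G))
    × ((∀ u' v' → Precedes G u' v' u v → u' ∠ v' within G) →
       Σ (Rel n) λ R → IsCoLex G R × R u v ×
         (∀ (R' : Rel n) → IsCoLex G R' → R' u v → ∀ x y → R x y → R' x y))
lemma5 G u v u≢v = mk⇔ necessary sufficient , minimum
  where
  necessary : (Σ (Rel _) λ R → IsCoLex G R × R u v) → PrecedingOrdered G u v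
  necessary (R , c , Ruv) = IsCoLex⇒PrecedingOrdered c Ruv

  minimum : PrecedingOrdered G u v → Σ (Rel _) λ R → IsCoLex G R × R u v ×
    (∀ (R' : Rel _) → IsCoLex G R' → R' u v → ∀ x y → R x y → R' x y)
  minimum ordered = PrecedingClosure G u v , PrecedingClosure-isCoLex ordered
    , inj₂ (here u≢v) , λ R' c R'uv → PrecedingClosure-minimal c R'uv

  sufficient : PrecedingOrdered G u v → Σ (Rel _) λ R → IsCoLex G R × R u v
  sufficient ordered =
    PrecedingClosure G u v , PrecedingClosure-isCoLex ordered , inj₂ (here u≢v)
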